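{- Let $\lambda\in\mathbb{C}$ with $\lambda\neq 1$, let $r,k\in\mathbb{Z}$ and $n\geq 0$. Then \[ T_{n}^{(r,k)}(x|\lambda)=\sum_{m=0}^{n}\frac{1}{(m+1)^k}\sum_{j=0}^{m}(-1)^j \binom{m}{j}\sum_{l=0}^{n}\binom{n}{l}H_{n-l}^{(r)}(\lambda)(x-j)^{l}. \]
   Context: For $k\in\mathbb{Z}$, $Li_k(x)=\sum_{n\ge1}x^n/n^k$ (polylogarithm), so that $\frac{Li_k(1-e^{ -t})}{1-e^{ -t}}=\sum_{m\ge 0}\frac{(1-e^{ -t})^m}{(m+1)^k}$ is a formal power series in $t$. The higher-order Frobenius-Euler and poly-Bernoulli mixed type polynomials $T_n^{(r,k)}(x|\lambda)$ are defined by the generating function $\left(\frac{1-\lambda}{e^t-\lambda}\right)^r\frac{Li_{k}(1-e^{ -t})}{1-e^{ -t}}e^{xt}=\sum_{n\ge0}T_n^{(r,k)}(x|\lambda)\frac{t^n}{n!}$. The Frobenius-Euler numbers of order $r$ are defined by $\left(\frac{1-\lambda}{e^t-\lambda}\right)^{r}=\sum_{n\ge0}H_n^{(r)}(\lambda)\frac{t^n}{n!}$. -}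

module Defs where

open import Level using (_⊔_) renaming (suc to lsuc)
open import Algebra.Bundles using (CommutativeRing)
open import Data.Nat using (ℕ; zero; suc; _∸_; _≤?_)
open import Data.Nat.Combinatorics using (_C_)
open import Data.Nat.Base using (_!)
open import Data.Integer using (ℤ; +_; -[1+_])
open import Relation.Nullary using (¬_; yes; no)

embed : ∀ {c ℓ} (R : CommutativeRing c ℓ) → ℕ → CommutativeRing.Carrier R
embed R zero    = CommutativeRing.0# R
embed R (suc n) = CommutativeRing._+_ R (CommutativeRing.1# R) (embed R n)

-- A field of characteristic zero (e.g. ℂ): a commutative ring with an
-- inverse operation that is a genuine inverse on nonzero elements, and in
-- which no positive integer n·1 vanishes (this also gives 1 ≉ 0).
record CharZeroField c ℓ : Set (lsuc (c ⊔ ℓ)) where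
  field
    commutativeRing : CommutativeRing c ℓ
  open CommutativeRing commutativeRing public
  field
    _⁻¹        : Carrier → Carrier
    ⁻¹-inverse : ∀ x → ¬ (x ≈ 0#) → x * (x ⁻¹) ≈ 1#
    charZero   : ∀ n → ¬ (embed commutativeRing (suc n) ≈ 0#)

-- Formal power series in t over a char-0 field K, as coefficient sequences:
-- f = Σ_{n≥0} f n · t^n.
module Series {c ℓ} (K : CharZeroField c ℓ) where
  open CharZeroField K public

  ι : ℕ → Carrier
  ι = embed commutativeRing

  _^_ : Carrier → ℕ → Carrier
  a ^ zero  = 1#
  a ^ suc n = a * (a ^ n)

  invZPow : Carrier → ℤ → Carrier
  invZPow a (+ k)     = (a ^ k) ⁻¹
  invZPow a -[1+ k ]  = a ^ suc k

  sumTo : ℕ → (ℕ → Carrier) → Carrier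
  sumTo zero    f = f 0
  sumTo (suc n) f = sumTo n f + f (suc n)

  PS : Set c
  PS = ℕ → Carrier

  const : Carrier → PS
  const a zero    = a
  const a (suc n) = 0#

  _⊕_ : PS → PS → PS
  (f ⊕ g) n = f n + g n

  _⊖_ : PS → PS → PS
  (f ⊖ g) n = f n - g n

  scale : Carrier → PS → PS
  scale a f n = a * f n

  _⊛_ : PS → PS → PS
  (f ⊛ g) n = sumTo n (λ i → f i * g (n ∸ i))

  powPS : PS → ℕ → PS
  powPS f zero    = const 1#
  powPS f (suc n) = f ⊛ powPS f n

  -- multiplicative inverse of a series with invertible constant term:
  -- b 0 = (f 0)⁻¹,  b n = - (f 0)⁻¹ · Σ_{j=1}^{n} f j · b (n - j)   (n ≥ 1).
  -- invUpTo n i is correct for all i ≤ n.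
  invUpTo : PS → ℕ → PS
  invUpTo f zero    i = (f 0) ⁻¹
  invUpTo f (suc n) i with i ≤? n
  ... | yes _ = invUpTo f n i
  ... | no  _ = - ((f 0) ⁻¹ * sumTo n (λ j → f (suc j) * invUpTo f n (n ∸ j)))

  invPS : PS → PS
  invPS f n = invUpTo f n n

  zpowPS : PS → ℤ → PS
  zpowPS f (+ n)     = powPS f n
  zpowPS f -[1+ n ]  = powPS (invPS f) (suc n)

  expS : Carrier → PS
  expS a n = (a ^ n) * (ι (n !)) ⁻¹

  -- composition  (Σ_m c m y^m) ∘ g  for g with zero constant term:
  -- coefficient of t^n is Σ_{m=0}^{n} c m · [t^n] g^m (terms m > n vanish).
  compose : (ℕ → Carrier) → PS → PS
  compose cs g n = sumTo n (λ m → cs m * powPS g m n)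

  FE : Carrier → ℤ → PS
  FE lam r = zpowPS (scale (1# - lam) (invPS (expS 1# ⊖ const lam))) r

  -- Li_k(y)/y = Σ_{m≥0} y^m/(m+1)^k, evaluated at y = 1 - e^{-t}
  LiQuot : ℤ → PS
  LiQuot k = compose (λ m → invZPow (ι (suc m)) k) (const 1# ⊖ expS (- 1#))

  H : ℤ → Carrier → ℕ → Carrier
  H r lam n = ι (n !) * FE lam r n

  T : ℤ → ℤ → Carrier → Carrier → ℕ → Carrier
  T r k x lam n = ι (n !) * ((FE lam r ⊛ LiQuot k) ⊛ expS x) n

{-# OPTIONS --safe #-}
-- Write g = 1 - e^{-t}.  Since g has no constant term, g^m = O(t^m), so the
-- coefficient of t^n in Li_k(g)/g only involves Σ_{m ≤ n} g^m/(m+1)^k.  By the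
-- binomial theorem g^m e^{xt} = Σ_j (-1)^j C(m,j) e^{(x-j)t}, and for any series
-- F the Cauchy product n! [t^n] F e^{yt} = Σ_l C(n,l) ((n-l)! F_{n-l}) y^l.
module Submission where

open import Defs
open import Data.Nat.Base as ℕ using (ℕ; zero; suc; _∸_; _≤_; _<_; z≤n; s≤s; _!)
open import Data.Nat.Properties
  using (≤-refl; ≤-trans; ≤-pred; ≤-<-trans; m≤n⇒m≤1+n; m≤n⇒m<n∨m≡n; n<1+n; m∸n≤m;
         +-∸-assoc; n∸n≡0; m∸n+n≡m; m+n∸n≡m; ∸-+-assoc; m∸[m∸n]≡n; 1≤n!; _!*_!≢0)
  renaming (+-comm to ℕ-+-comm)
open import Data.Nat.Combinatorics
  using (_C_; k![n∸k]!∣n!; nCk≡n!/k![n-k]!; k>n⇒nCk≡0; nCk+nC[k+1]≡[n+1]C[k+1])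
open import Data.Nat.DivMod using (m/n*n≡m)
open import Data.Integer using (ℤ)
open import Data.Sum using (inj₁; inj₂)
open import Relation.Binary.PropositionalEquality as ≡ using (_≡_)
open import Relation.Nullary using (¬_)
import Algebra.Properties.AbelianGroup as AbelianGroupProperties
import Algebra.Properties.CommutativeSemigroup as CommutativeSemigroupProperties
import Algebra.Properties.Ring as RingProperties
import Relation.Binary.Reasoning.Setoid as SetoidReasoning
import Algebra.Solver.Ring.NaturalCoefficients.Default as NaturalCoefficientsSolver

n!≡nCk*[k!*[n∸k]!] : ∀ {n k} → k ≤ n → n ! ≡ (n C k) ℕ.* (k ! ℕ.* (n ∸ k) !)
n!≡nCk*[k!*[n∸k]!] {n} {k} k≤n = ≡.trans (≡.sym (m/n*n≡m (k![n∸k]!∣n! k≤n)))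
  (≡.cong (ℕ._* (k ! ℕ.* (n ∸ k) !)) (≡.sym (nCk≡n!/k![n-k]! k≤n)))
  where instance _ = k !* (n ∸ k) !≢0

module Expansion {c ℓ} (K : CharZeroField c ℓ) where
  open Series K
  open SetoidReasoning setoid
  open AbelianGroupProperties +-abelianGroup using (ε⁻¹≈ε; ⁻¹-∙-comm)
  open CommutativeSemigroupProperties +-commutativeSemigroup using (interchange)
  open RingProperties ring using (-1*x≈-x; -‿distribˡ-*; x[y-z]≈xy-xz; [y-z]x≈yx-zx)
  open NaturalCoefficientsSolver commutativeSemiring using (solve; _:+_; _:*_; _:=_)

  ι-homo-+ : ∀ m n → ι (m ℕ.+ n) ≈ ι m + ι n
  ι-homo-+ zero    n = sym (+-identityˡ _)
  ι-homo-+ (suc m) n = trans (+-congˡ (ι-homo-+ m n)) (sym (+-assoc _ _ _))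

  ι-homo-* : ∀ m n → ι (m ℕ.* n) ≈ ι m * ι n
  ι-homo-* zero    n = sym (zeroˡ _)
  ι-homo-* (suc m) n = begin
    ι (n ℕ.+ m ℕ.* n)     ≈⟨ ι-homo-+ n (m ℕ.* n) ⟩
    ι n + ι (m ℕ.* n)     ≈⟨ +-cong (sym (*-identityˡ _)) (ι-homo-* m n) ⟩
    1# * ι n + ι m * ι n  ≈⟨ sym (distribʳ _ _ _) ⟩
    (1# + ι m) * ι n      ∎

  ^-congˡ : ∀ {a b} n → a ≈ b → a ^ n ≈ b ^ n
  ^-congˡ zero    a≈b = refl
  ^-congˡ (suc n) a≈b = *-cong a≈b (^-congˡ n a≈b)

  sumTo-cong-≤ : ∀ n {f g : ℕ → Carrier} → (∀ i → i ≤ n → f i ≈ g i) → sumTo n f ≈ sumTo n g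
  sumTo-cong-≤ zero    f≈g = f≈g 0 z≤n
  sumTo-cong-≤ (suc n) f≈g =
    +-cong (sumTo-cong-≤ n (λ i i≤n → f≈g i (m≤n⇒m≤1+n i≤n))) (f≈g (suc n) ≤-refl)

  sumTo-cong : ∀ n {f g : ℕ → Carrier} → (∀ i → f i ≈ g i) → sumTo n f ≈ sumTo n g
  sumTo-cong n f≈g = sumTo-cong-≤ n (λ i _ → f≈g i)

  sumTo-zero : ∀ n {f : ℕ → Carrier} → (∀ i → i ≤ n → f i ≈ 0#) → sumTo n f ≈ 0#
  sumTo-zero zero    f≈0 = f≈0 0 z≤n
  sumTo-zero (suc n) f≈0 = trans
    (+-cong (sumTo-zero n (λ i i≤n → f≈0 i (m≤n⇒m≤1+n i≤n))) (f≈0 (suc n) ≤-refl))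
    (+-identityʳ 0#)

  sumTo-distrib-+ : ∀ n (f g : ℕ → Carrier) →
    sumTo n (λ i → f i + g i) ≈ sumTo n f + sumTo n g
  sumTo-distrib-+ zero    f g = refl
  sumTo-distrib-+ (suc n) f g = trans (+-congʳ (sumTo-distrib-+ n f g)) (interchange _ _ _ _)

  -‿distrib-sumTo : ∀ n (f : ℕ → Carrier) → - sumTo n f ≈ sumTo n (λ i → - f i)
  -‿distrib-sumTo zero    f = refl
  -‿distrib-sumTo (suc n) f = trans (sym (⁻¹-∙-comm _ _)) (+-congʳ (-‿distrib-sumTo n f))

  sumTo-distrib-- : ∀ n (f g : ℕ → Carrier) →
    sumTo n (λ i → f i - g i) ≈ sumTo n f - sumTo n g
  sumTo-distrib-- n f g =
    trans (sumTo-distrib-+ n f (λ i → - g i)) (+-congˡ (sym (-‿distrib-sumTo n g)))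

  *-distribˡ-sumTo : ∀ n a (f : ℕ → Carrier) → a * sumTo n f ≈ sumTo n (λ i → a * f i)
  *-distribˡ-sumTo zero    a f = refl
  *-distribˡ-sumTo (suc n) a f = trans (distribˡ _ _ _) (+-congʳ (*-distribˡ-sumTo n a f))

  *-distribʳ-sumTo : ∀ n a (f : ℕ → Carrier) → sumTo n f * a ≈ sumTo n (λ i → f i * a)
  *-distribʳ-sumTo zero    a f = refl
  *-distribʳ-sumTo (suc n) a f = trans (distribʳ _ _ _) (+-congʳ (*-distribʳ-sumTo n a f))

  x*Σyz≈Σy*xz : ∀ n a (b f : ℕ → Carrier) →
    a * sumTo n (λ i → b i * f i) ≈ sumTo n (λ i → b i * (a * f i))
  x*Σyz≈Σy*xz n a b f = trans (*-distribˡ-sumTo n a _)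
    (sumTo-cong n (λ i → solve 3 (λ a b f → a :* (b :* f) := b :* (a :* f)) refl a (b i) (f i)))

  sumTo-suc : ∀ n (f : ℕ → Carrier) → sumTo (suc n) f ≈ f 0 + sumTo n (λ i → f (suc i))
  sumTo-suc zero    f = refl
  sumTo-suc (suc n) f = trans (+-congʳ (sumTo-suc n f)) (+-assoc _ _ _)

  sumTo-comm : ∀ n m (f : ℕ → ℕ → Carrier) →
    sumTo n (λ i → sumTo m (λ j → f i j)) ≈ sumTo m (λ j → sumTo n (λ i → f i j))
  sumTo-comm zero    m f = refl
  sumTo-comm (suc n) m f = trans (+-congʳ (sumTo-comm n m f)) (sym (sumTo-distrib-+ m _ _))

  sumTo-reverse : ∀ n (f : ℕ → Carrier) → sumTo n f ≈ sumTo n (λ i → f (n ∸ i))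
  sumTo-reverse zero    f = refl
  sumTo-reverse (suc n) f = trans (+-congʳ (sumTo-reverse n f))
    (trans (+-comm _ _) (sym (sumTo-suc n (λ i → f (suc n ∸ i)))))

  sumTo-truncate : ∀ {p} n (f : ℕ → Carrier) → p ≤ n →
    (∀ j → p < j → j ≤ n → f j ≈ 0#) → sumTo n f ≈ sumTo p f
  sumTo-truncate zero    f z≤n f≈0 = refl
  sumTo-truncate (suc n) f p≤1+n f≈0 with m≤n⇒m<n∨m≡n p≤1+n
  ... | inj₂ ≡.refl = refl
  ... | inj₁ p<1+n  = trans
    (+-cong (sumTo-truncate n f (≤-pred p<1+n) (λ j p<j j≤n → f≈0 j p<j (m≤n⇒m≤1+n j≤n)))
            (f≈0 (suc n) p<1+n ≤-refl))
    (+-identityʳ _)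

  sumTo-triangle : ∀ n (f : ℕ → ℕ → Carrier) →
    sumTo n (λ p → sumTo p (λ i → f i p)) ≈ sumTo n (λ i → sumTo (n ∸ i) (λ q → f i (q ℕ.+ i)))
  sumTo-triangle zero    f = refl
  sumTo-triangle (suc n) f = begin
    sumTo n (λ p → sumTo p (λ i → f i p)) + (sumTo n (λ i → f i (suc n)) + f (suc n) (suc n))
      ≈⟨ +-congʳ (sumTo-triangle n f) ⟩
    sumTo n row + (sumTo n (λ i → f i (suc n)) + f (suc n) (suc n))
      ≈⟨ sym (+-assoc _ _ _) ⟩
    (sumTo n row + sumTo n (λ i → f i (suc n))) + f (suc n) (suc n)
      ≈⟨ +-cong (sym (sumTo-distrib-+ n _ _)) last ⟩
    sumTo n (λ i → row i + f i (suc n)) + sumTo (n ∸ n) (λ q → f (suc n) (q ℕ.+ suc n))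
      ≈⟨ +-congʳ (sumTo-cong-≤ n extend) ⟩
    sumTo (suc n) (λ i → sumTo (suc n ∸ i) (λ q → f i (q ℕ.+ i))) ∎
    where
    row : ℕ → Carrier
    row i = sumTo (n ∸ i) (λ q → f i (q ℕ.+ i))
    last : f (suc n) (suc n) ≈ sumTo (n ∸ n) (λ q → f (suc n) (q ℕ.+ suc n))
    last rewrite n∸n≡0 n = refl
    extend : ∀ i → i ≤ n → row i + f i (suc n) ≈ sumTo (suc n ∸ i) (λ q → f i (q ℕ.+ i))
    extend i i≤n rewrite +-∸-assoc 1 i≤n =
      +-congˡ (reflexive (≡.cong (λ m → f i (suc m)) (≡.sym (m∸n+n≡m i≤n))))

  ⊛-congˡ : ∀ (h f f′ : PS) n → (∀ i → i ≤ n → f i ≈ f′ i) → (h ⊛ f) n ≈ (h ⊛ f′) n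
  ⊛-congˡ h f f′ n f≈f′ = sumTo-cong n (λ i → *-congˡ (f≈f′ (n ∸ i) (m∸n≤m n i)))

  ⊛-congʳ : ∀ (h f f′ : PS) n → (∀ i → i ≤ n → f i ≈ f′ i) → (f ⊛ h) n ≈ (f′ ⊛ h) n
  ⊛-congʳ h f f′ n f≈f′ = sumTo-cong-≤ n (λ i i≤n → *-congʳ (f≈f′ i i≤n))

  ⊛-assoc : ∀ (a b c : PS) n → ((a ⊛ b) ⊛ c) n ≈ (a ⊛ (b ⊛ c)) n
  ⊛-assoc a b c n = begin
    sumTo n (λ p → sumTo p (λ i → a i * b (p ∸ i)) * c (n ∸ p))
      ≈⟨ sumTo-cong n (λ p → *-distribʳ-sumTo p _ _) ⟩
    sumTo n (λ p → sumTo p (λ i → a i * b (p ∸ i) * c (n ∸ p)))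
      ≈⟨ sumTo-triangle n _ ⟩
    sumTo n (λ i → sumTo (n ∸ i) (λ q → a i * b (q ℕ.+ i ∸ i) * c (n ∸ (q ℕ.+ i))))
      ≈⟨ sumTo-cong n (λ i → sumTo-cong (n ∸ i) (λ q → trans (*-assoc _ _ _) (reindex i q))) ⟩
    sumTo n (λ i → sumTo (n ∸ i) (λ q → a i * (b q * c (n ∸ i ∸ q))))
      ≈⟨ sumTo-cong n (λ i → sym (*-distribˡ-sumTo (n ∸ i) _ _)) ⟩
    (a ⊛ (b ⊛ c)) n ∎
    where
    reindex : ∀ i q → a i * (b (q ℕ.+ i ∸ i) * c (n ∸ (q ℕ.+ i))) ≈ a i * (b q * c (n ∸ i ∸ q))
    reindex i q = *-congˡ (*-cong (reflexive (≡.cong b (m+n∸n≡m q i)))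
      (reflexive (≡.cong c (≡.trans (≡.cong (n ∸_) (ℕ-+-comm q i)) (≡.sym (∸-+-assoc n i q))))))

  ⊛-distribˡ-sumTo : ∀ m (a : ℕ → Carrier) (h : ℕ → PS) (f : PS) n →
    (f ⊛ (λ p → sumTo m (λ j → a j * h j p))) n ≈ sumTo m (λ j → a j * (f ⊛ h j) n)
  ⊛-distribˡ-sumTo m a h f n = begin
    sumTo n (λ i → f i * sumTo m (λ j → a j * h j (n ∸ i)))
      ≈⟨ sumTo-cong n (λ i → x*Σyz≈Σy*xz m (f i) a (λ j → h j (n ∸ i))) ⟩
    sumTo n (λ i → sumTo m (λ j → a j * (f i * h j (n ∸ i))))
      ≈⟨ sumTo-comm n m _ ⟩
    sumTo m (λ j → sumTo n (λ i → a j * (f i * h j (n ∸ i))))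
      ≈⟨ sumTo-cong m (λ j → sym (*-distribˡ-sumTo n _ _)) ⟩
    sumTo m (λ j → a j * (f ⊛ h j) n) ∎

  ⊛-distribʳ-sumTo : ∀ m (a : ℕ → Carrier) (h : ℕ → PS) (f : PS) n →
    ((λ p → sumTo m (λ j → a j * h j p)) ⊛ f) n ≈ sumTo m (λ j → a j * (h j ⊛ f) n)
  ⊛-distribʳ-sumTo m a h f n = begin
    sumTo n (λ i → sumTo m (λ j → a j * h j i) * f (n ∸ i))
      ≈⟨ sumTo-cong n (λ i → *-distribʳ-sumTo m _ _) ⟩
    sumTo n (λ i → sumTo m (λ j → a j * h j i * f (n ∸ i)))
      ≈⟨ sumTo-comm n m _ ⟩
    sumTo m (λ j → sumTo n (λ i → a j * h j i * f (n ∸ i)))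
      ≈⟨ sumTo-cong m (λ j → trans (sumTo-cong n (λ i → *-assoc _ _ _)) (sym (*-distribˡ-sumTo n _ _))) ⟩
    sumTo m (λ j → a j * (h j ⊛ f) n) ∎

  ⊛-distribʳ-⊖ : ∀ (f g h : PS) n → ((f ⊖ g) ⊛ h) n ≈ (f ⊛ h) n - (g ⊛ h) n
  ⊛-distribʳ-⊖ f g h n = trans
    (sumTo-cong n (λ i → [y-z]x≈yx-zx _ _ _))
    (sumTo-distrib-- n _ _)

  const-⊛ : ∀ a (h : PS) n → (const a ⊛ h) n ≈ a * h n
  const-⊛ a h zero    = refl
  const-⊛ a h (suc n) = trans (sumTo-suc n _)
    (trans (+-congˡ (sumTo-zero n (λ i _ → zeroˡ _))) (+-identityʳ _))

  powPS-vanishes-below : ∀ {g : PS} → g 0 ≈ 0# → ∀ m i → i < m → powPS g m i ≈ 0#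
  powPS-vanishes-below     g₀≈0 (suc m) zero    _ = trans (*-congʳ g₀≈0) (zeroˡ _)
  powPS-vanishes-below {g} g₀≈0 (suc m) (suc i) (s≤s i<m) = trans (sumTo-suc i _)
    (trans (+-cong (trans (*-congʳ g₀≈0) (zeroˡ _)) (sumTo-zero i higher)) (+-identityˡ 0#))
    where
    higher : ∀ p → p ≤ i → g (suc p) * powPS g m (i ∸ p) ≈ 0#
    higher p _ = trans (*-congˡ (powPS-vanishes-below g₀≈0 m (i ∸ p) (≤-<-trans (m∸n≤m i p) i<m)))
                       (zeroʳ _)

  compose-truncate : ∀ {g : PS} → g 0 ≈ 0# → ∀ cs {p} n → p ≤ n →
    compose cs g p ≈ sumTo n (λ m → cs m * powPS g m p)
  compose-truncate g₀≈0 cs n p≤n = sym (sumTo-truncate n _ p≤n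
    (λ m p<m _ → trans (*-congˡ (powPS-vanishes-below g₀≈0 m _ p<m)) (zeroʳ _)))

  ⊛-compose-⊛ : ∀ {g : PS} → g 0 ≈ 0# → ∀ (F : PS) cs (E : PS) n →
    ((F ⊛ compose cs g) ⊛ E) n ≈ sumTo n (λ m → cs m * (F ⊛ (powPS g m ⊛ E)) n)
  ⊛-compose-⊛ {g} g₀≈0 F cs E n = begin
    ((F ⊛ compose cs g) ⊛ E) n
      ≈⟨ ⊛-congʳ E _ _ n (λ p p≤n →
           ⊛-congˡ F _ _ p (λ q q≤p → compose-truncate {g} g₀≈0 cs n (≤-trans q≤p p≤n))) ⟩
    ((F ⊛ (λ p → sumTo n (λ m → cs m * powPS g m p))) ⊛ E) n
      ≈⟨ ⊛-congʳ E _ _ n (λ p _ → ⊛-distribˡ-sumTo n cs (powPS g) F p) ⟩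
    ((λ p → sumTo n (λ m → cs m * (F ⊛ powPS g m) p)) ⊛ E) n
      ≈⟨ ⊛-distribʳ-sumTo n cs (λ m → F ⊛ powPS g m) E n ⟩
    sumTo n (λ m → cs m * ((F ⊛ powPS g m) ⊛ E) n)
      ≈⟨ sumTo-cong n (λ m → *-congˡ (⊛-assoc F (powPS g m) E n)) ⟩
    sumTo n (λ m → cs m * (F ⊛ (powPS g m ⊛ E)) n) ∎

  ι[n!]≉0 : ∀ n → ¬ (ι (n !) ≈ 0#)
  ι[n!]≉0 n with n ! | 1≤n! n
  ... | suc m | _ = charZero m

  ι[n!]*ι[n!]⁻¹≈1 : ∀ n → ι (n !) * ι (n !) ⁻¹ ≈ 1#
  ι[n!]*ι[n!]⁻¹≈1 n = ⁻¹-inverse _ (ι[n!]≉0 n)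

  x*[n!/n!]≈x : ∀ x n → x * (ι (n !) * ι (n !) ⁻¹) ≈ x
  x*[n!/n!]≈x x n = trans (*-congˡ (ι[n!]*ι[n!]⁻¹≈1 n)) (*-identityʳ x)

  ι[n!]≈ι[nCk]*[ι[k!]*ι[[n∸k]!]] : ∀ {n k} → k ≤ n →
    ι (n !) ≈ ι (n C k) * (ι (k !) * ι ((n ∸ k) !))
  ι[n!]≈ι[nCk]*[ι[k!]*ι[[n∸k]!]] {n} {k} k≤n =
    trans (reflexive (≡.cong ι (n!≡nCk*[k!*[n∸k]!] k≤n)))
    (trans (ι-homo-* (n C k) _) (*-congˡ (ι-homo-* (k !) _)))

  n!/k!≈nCk*[n∸k]! : ∀ {n k} → k ≤ n → ι (n !) * ι (k !) ⁻¹ ≈ ι (n C k) * ι ((n ∸ k) !)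
  n!/k!≈nCk*[n∸k]! {n} {k} k≤n = begin
    n! * k! ⁻¹               ≈⟨ *-congʳ (ι[n!]≈ι[nCk]*[ι[k!]*ι[[n∸k]!]] k≤n) ⟩
    nCk * (k! * d!) * k! ⁻¹  ≈⟨ solve 4 (λ a b c e → a :* (b :* c) :* e := a :* c :* (b :* e))
                                      refl nCk k! d! (k! ⁻¹) ⟩
    nCk * d! * (k! * k! ⁻¹)  ≈⟨ x*[n!/n!]≈x (nCk * d!) k ⟩
    nCk * d!                 ∎
    where
    n! k! d! nCk : Carrier
    n! = ι (n !)
    k! = ι (k !)
    d! = ι ((n ∸ k) !)
    nCk = ι (n C k)

  1/k![n∸k]!≈nCk/n! : ∀ {n k} → k ≤ n → ι (k !) ⁻¹ * ι ((n ∸ k) !) ⁻¹ ≈ ι (n C k) * ι (n !) ⁻¹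
  1/k![n∸k]!≈nCk/n! {n} {k} k≤n = begin
    k! ⁻¹ * d! ⁻¹                  ≈⟨ sym (x*[n!/n!]≈x _ n) ⟩
    k! ⁻¹ * d! ⁻¹ * (n! * n! ⁻¹)   ≈⟨ solve 4 (λ a b c e → a :* b :* (c :* e) := c :* a :* b :* e)
                                            refl (k! ⁻¹) (d! ⁻¹) n! (n! ⁻¹) ⟩
    n! * k! ⁻¹ * d! ⁻¹ * n! ⁻¹     ≈⟨ *-congʳ (*-congʳ (n!/k!≈nCk*[n∸k]! k≤n)) ⟩
    nCk * d! * d! ⁻¹ * n! ⁻¹       ≈⟨ *-congʳ (trans (*-assoc _ _ _) (x*[n!/n!]≈x nCk (n ∸ k))) ⟩
    nCk * n! ⁻¹                    ∎
    where
    n! k! d! nCk : Carrier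
    n! = ι (n !)
    k! = ι (k !)
    d! = ι ((n ∸ k) !)
    nCk = ι (n C k)

  pascal-sumTo : ∀ m (w : ℕ → Carrier) →
    sumTo (suc m) (λ j → ι (suc m C j) * w j) ≈
      sumTo m (λ j → ι (m C j) * w j) + sumTo m (λ j → ι (m C j) * w (suc j))
  pascal-sumTo m w = begin
    sumTo (suc m) (λ j → ι (suc m C j) * w j)
      ≈⟨ sumTo-suc m _ ⟩
    ι 1 * w 0 + sumTo m (λ j → ι (suc m C suc j) * w (suc j))
      ≈⟨ +-congˡ (sumTo-cong m pascal) ⟩
    ι 1 * w 0 + sumTo m (λ j → ι (m C j) * w (suc j) + ι (m C suc j) * w (suc j))
      ≈⟨ +-congˡ (sumTo-distrib-+ m _ _) ⟩
    ι 1 * w 0 + (sumTo m (λ j → ι (m C j) * w (suc j)) + sumTo m (λ j → ι (m C suc j) * w (suc j)))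
      ≈⟨ solve 3 (λ x y z → x :+ (y :+ z) := (x :+ z) :+ y) refl _ _ _ ⟩
    (ι 1 * w 0 + sumTo m (λ j → ι (m C suc j) * w (suc j))) + sumTo m (λ j → ι (m C j) * w (suc j))
      ≈⟨ +-congʳ (sym (sumTo-suc m _)) ⟩
    sumTo (suc m) (λ j → ι (m C j) * w j) + sumTo m (λ j → ι (m C j) * w (suc j))
      ≈⟨ +-congʳ (trans (+-congˡ top) (+-identityʳ _)) ⟩
    sumTo m (λ j → ι (m C j) * w j) + sumTo m (λ j → ι (m C j) * w (suc j)) ∎
    where
    pascal : ∀ j → ι (suc m C suc j) * w (suc j) ≈ ι (m C j) * w (suc j) + ι (m C suc j) * w (suc j)
    pascal j = trans (*-congʳ (trans (reflexive (≡.cong ι (≡.sym (nCk+nC[k+1]≡[n+1]C[k+1] m j))))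
                                     (ι-homo-+ (m C j) (m C suc j))))
                     (distribʳ _ _ _)
    top : ι (m C suc m) * w (suc m) ≈ 0#
    top = trans (*-congʳ (reflexive (≡.cong ι (k>n⇒nCk≡0 (n<1+n m))))) (zeroˡ _)

  binomial-theorem : ∀ n a b → (a + b) ^ n ≈ sumTo n (λ i → ι (n C i) * (a ^ i * b ^ (n ∸ i)))
  binomial-theorem zero    a b = sym (trans (*-cong (+-identityʳ 1#) (*-identityˡ 1#)) (*-identityˡ 1#))
  binomial-theorem (suc n) a b = begin
    (a + b) * (a + b) ^ n
      ≈⟨ *-congˡ (binomial-theorem n a b) ⟩
    (a + b) * S
      ≈⟨ trans (distribʳ _ _ _) (+-comm _ _) ⟩
    b * S + a * S
      ≈⟨ +-cong (trans (*-distribˡ-sumTo n b _) (sumTo-cong-≤ n raise-b))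
                (trans (*-distribˡ-sumTo n a _) (sumTo-cong n raise-a)) ⟩
    sumTo n (λ j → ι (n C j) * w j) + sumTo n (λ j → ι (n C j) * w (suc j))
      ≈⟨ sym (pascal-sumTo n w) ⟩
    sumTo (suc n) (λ i → ι (suc n C i) * (a ^ i * b ^ (suc n ∸ i))) ∎
    where
    S : Carrier
    S = sumTo n (λ i → ι (n C i) * (a ^ i * b ^ (n ∸ i)))
    w : ℕ → Carrier
    w j = a ^ j * b ^ (suc n ∸ j)
    raise-a : ∀ j → a * (ι (n C j) * (a ^ j * b ^ (n ∸ j))) ≈ ι (n C j) * w (suc j)
    raise-a j = solve 4 (λ a u x y → a :* (u :* (x :* y)) := u :* ((a :* x) :* y)) refl _ _ _ _
    raise-b : ∀ j → j ≤ n → b * (ι (n C j) * (a ^ j * b ^ (n ∸ j))) ≈ ι (n C j) * w j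
    raise-b j j≤n = trans (solve 4 (λ b u x y → b :* (u :* (x :* y)) := u :* (x :* (b :* y))) refl _ _ _ _)
      (*-congˡ (*-congˡ (reflexive (≡.cong (b ^_) (≡.sym (+-∸-assoc 1 j≤n))))))

  expS-cong : ∀ {a b} n → a ≈ b → expS a n ≈ expS b n
  expS-cong n a≈b = *-congʳ (^-congˡ n a≈b)

  expS-+ : ∀ a b n → (expS a ⊛ expS b) n ≈ expS (a + b) n
  expS-+ a b n = begin
    sumTo n (λ i → (a ^ i * ι (i !) ⁻¹) * (b ^ (n ∸ i) * ι ((n ∸ i) !) ⁻¹))
      ≈⟨ sumTo-cong-≤ n term ⟩
    sumTo n (λ i → (ι (n C i) * (a ^ i * b ^ (n ∸ i))) * ι (n !) ⁻¹)
      ≈⟨ sym (*-distribʳ-sumTo n _ _) ⟩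
    sumTo n (λ i → ι (n C i) * (a ^ i * b ^ (n ∸ i))) * ι (n !) ⁻¹
      ≈⟨ *-congʳ (sym (binomial-theorem n a b)) ⟩
    expS (a + b) n ∎
    where
    term : ∀ i → i ≤ n → (a ^ i * ι (i !) ⁻¹) * (b ^ (n ∸ i) * ι ((n ∸ i) !) ⁻¹) ≈
                         (ι (n C i) * (a ^ i * b ^ (n ∸ i))) * ι (n !) ⁻¹
    term i i≤n = begin
      (a ^ i * ι (i !) ⁻¹) * (b ^ (n ∸ i) * ι ((n ∸ i) !) ⁻¹)
        ≈⟨ solve 4 (λ x u y v → (x :* u) :* (y :* v) := (u :* v) :* (x :* y)) refl _ _ _ _ ⟩
      (ι (i !) ⁻¹ * ι ((n ∸ i) !) ⁻¹) * (a ^ i * b ^ (n ∸ i))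
        ≈⟨ *-congʳ (1/k![n∸k]!≈nCk/n! i≤n) ⟩
      (ι (n C i) * ι (n !) ⁻¹) * (a ^ i * b ^ (n ∸ i))
        ≈⟨ solve 3 (λ u v z → (u :* v) :* z := (u :* z) :* v) refl _ _ _ ⟩
      (ι (n C i) * (a ^ i * b ^ (n ∸ i))) * ι (n !) ⁻¹ ∎

  1-e⁻ᵗ : PS
  1-e⁻ᵗ = const 1# ⊖ expS (- 1#)

  1-e⁻ᵗ-constant≈0 : 1-e⁻ᵗ 0 ≈ 0#
  1-e⁻ᵗ-constant≈0 = trans (+-congˡ (-‿cong (trans (*-identityˡ _) 1⁻¹≈1))) (-‿inverseʳ 1#)
    where
    1⁻¹≈1 : ι 1 ⁻¹ ≈ 1#
    1⁻¹≈1 = trans (sym (*-identityˡ _)) (trans (*-congʳ (sym (+-identityʳ 1#))) (ι[n!]*ι[n!]⁻¹≈1 0))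

  1-e⁻ᵗ-⊛-expS : ∀ y n → (1-e⁻ᵗ ⊛ expS y) n ≈ expS y n - expS (y - 1#) n
  1-e⁻ᵗ-⊛-expS y n = trans (⊛-distribʳ-⊖ (const 1#) (expS (- 1#)) (expS y) n)
    (+-cong (trans (const-⊛ 1# (expS y) n) (*-identityˡ _))
            (-‿cong (trans (expS-+ (- 1#) y n) (expS-cong n (+-comm (- 1#) y)))))

  x-ι[1+j]≈x-ι[j]-1 : ∀ x j → x - ι (suc j) ≈ (x - ι j) - 1#
  x-ι[1+j]≈x-ι[j]-1 x j =
    trans (+-congˡ (trans (-‿cong (+-comm 1# (ι j))) (sym (⁻¹-∙-comm (ι j) 1#)))) (sym (+-assoc _ _ _))

  [-1]^j*[a-b]≈[-1]^j*a+[-1]^[1+j]*b : ∀ j a b →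
    (- 1#) ^ j * (a - b) ≈ (- 1#) ^ j * a + (- 1#) ^ suc j * b
  [-1]^j*[a-b]≈[-1]^j*a+[-1]^[1+j]*b j a b = begin
    s * (a - b)               ≈⟨ x[y-z]≈xy-xz s a b ⟩
    s * a - s * b             ≈⟨ +-congˡ (-‿distribˡ-* s b) ⟩
    s * a + (- s) * b         ≈⟨ +-congˡ (*-congʳ (sym (-1*x≈-x s))) ⟩
    s * a + (- 1# * s) * b    ∎
    where s = (- 1#) ^ j

  powPS-1-e⁻ᵗ-⊛-expS : ∀ x m n →
    (powPS 1-e⁻ᵗ m ⊛ expS x) n ≈ sumTo m (λ j → (- 1#) ^ j * ι (m C j) * expS (x - ι j) n)
  powPS-1-e⁻ᵗ-⊛-expS x zero n = trans (const-⊛ 1# (expS x) n)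
    (*-cong (sym (trans (*-identityˡ _) (+-identityʳ _)))
            (expS-cong n (sym (trans (+-congˡ ε⁻¹≈ε) (+-identityʳ x)))))
  powPS-1-e⁻ᵗ-⊛-expS x (suc m) n = begin
    ((1-e⁻ᵗ ⊛ powPS 1-e⁻ᵗ m) ⊛ expS x) n
      ≈⟨ ⊛-assoc 1-e⁻ᵗ (powPS 1-e⁻ᵗ m) (expS x) n ⟩
    (1-e⁻ᵗ ⊛ (powPS 1-e⁻ᵗ m ⊛ expS x)) n
      ≈⟨ ⊛-congˡ 1-e⁻ᵗ _ _ n (λ i _ → powPS-1-e⁻ᵗ-⊛-expS x m i) ⟩
    (1-e⁻ᵗ ⊛ (λ i → sumTo m (λ j → (- 1#) ^ j * ι (m C j) * expS (x - ι j) i))) n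
      ≈⟨ ⊛-distribˡ-sumTo m (λ j → (- 1#) ^ j * ι (m C j)) (λ j → expS (x - ι j)) 1-e⁻ᵗ n ⟩
    sumTo m (λ j → (- 1#) ^ j * ι (m C j) * (1-e⁻ᵗ ⊛ expS (x - ι j)) n)
      ≈⟨ sumTo-cong m split ⟩
    sumTo m (λ j → ι (m C j) * w j + ι (m C j) * w (suc j))
      ≈⟨ trans (sumTo-distrib-+ m _ _) (sym (pascal-sumTo m w)) ⟩
    sumTo (suc m) (λ j → ι (suc m C j) * w j)
      ≈⟨ sumTo-cong (suc m) (λ j → solve 3 (λ c s e → c :* (s :* e) := s :* c :* e) refl _ _ _) ⟩
    sumTo (suc m) (λ j → (- 1#) ^ j * ι (suc m C j) * expS (x - ι j) n) ∎
    where
    w : ℕ → Carrier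
    w j = (- 1#) ^ j * expS (x - ι j) n
    split : ∀ j → (- 1#) ^ j * ι (m C j) * (1-e⁻ᵗ ⊛ expS (x - ι j)) n ≈
                      ι (m C j) * w j + ι (m C j) * w (suc j)
    split j = begin
      (- 1#) ^ j * ι (m C j) * (1-e⁻ᵗ ⊛ expS (x - ι j)) n
        ≈⟨ *-congˡ (trans (1-e⁻ᵗ-⊛-expS (x - ι j) n)
                          (+-congˡ (-‿cong (expS-cong n (sym (x-ι[1+j]≈x-ι[j]-1 x j)))))) ⟩
      (- 1#) ^ j * ι (m C j) * (expS (x - ι j) n - expS (x - ι (suc j)) n)
        ≈⟨ solve 3 (λ s c d → s :* c :* d := c :* (s :* d)) refl _ _ _ ⟩
      ι (m C j) * ((- 1#) ^ j * (expS (x - ι j) n - expS (x - ι (suc j)) n))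
        ≈⟨ trans (*-congˡ ([-1]^j*[a-b]≈[-1]^j*a+[-1]^[1+j]*b j _ _)) (distribˡ _ _ _) ⟩
      ι (m C j) * w j + ι (m C j) * w (suc j) ∎

  n!*[F⊛expS]ₙ : ∀ (F : PS) y n → ι (n !) * (F ⊛ expS y) n ≈
    sumTo n (λ l → ι (n C l) * (ι ((n ∸ l) !) * F (n ∸ l)) * y ^ l)
  n!*[F⊛expS]ₙ F y n = begin
    ι (n !) * (F ⊛ expS y) n
      ≈⟨ trans (*-distribˡ-sumTo n _ _) (sumTo-reverse n _) ⟩
    sumTo n (λ l → ι (n !) * (F (n ∸ l) * expS y (n ∸ (n ∸ l))))
      ≈⟨ sumTo-cong-≤ n term ⟩
    sumTo n (λ l → ι (n C l) * (ι ((n ∸ l) !) * F (n ∸ l)) * y ^ l) ∎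
    where
    term : ∀ l → l ≤ n → ι (n !) * (F (n ∸ l) * expS y (n ∸ (n ∸ l))) ≈
                         ι (n C l) * (ι ((n ∸ l) !) * F (n ∸ l)) * y ^ l
    term l l≤n rewrite m∸[m∸n]≡n l≤n = begin
      ι (n !) * (F (n ∸ l) * (y ^ l * ι (l !) ⁻¹))
        ≈⟨ solve 4 (λ N f Y L → N :* (f :* (Y :* L)) := N :* L :* f :* Y) refl _ _ _ _ ⟩
      ι (n !) * ι (l !) ⁻¹ * F (n ∸ l) * y ^ l
        ≈⟨ *-congʳ (*-congʳ (n!/k!≈nCk*[n∸k]! l≤n)) ⟩
      ι (n C l) * ι ((n ∸ l) !) * F (n ∸ l) * y ^ l
        ≈⟨ *-congʳ (*-assoc _ _ _) ⟩
      ι (n C l) * (ι ((n ∸ l) !) * F (n ∸ l)) * y ^ l ∎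

theorem1 : ∀ {c ℓ} (K : CharZeroField c ℓ) →
    let open Series K in
    (lam : Carrier) → ¬ (lam ≈ 1#) → (r k : ℤ) (n : ℕ) (x : Carrier) →
    T r k x lam n ≈
      sumTo n (λ m → invZPow (ι (suc m)) k *
        sumTo m (λ j → ((- 1#) ^ j) * ι (m C j) *
          sumTo n (λ l → ι (n C l) * H r lam (n ∸ l) * ((x - ι j) ^ l))))
theorem1 K lam _ r k n x = begin
  ι (n !) * ((F ⊛ LiQuot k) ⊛ expS x) n
    ≈⟨ *-congˡ (⊛-compose-⊛ 1-e⁻ᵗ-constant≈0 F cs (expS x) n) ⟩
  ι (n !) * sumTo n (λ m → cs m * (F ⊛ (powPS 1-e⁻ᵗ m ⊛ expS x)) n)
    ≈⟨ *-congˡ (sumTo-cong n (λ m → *-congˡ (expand m))) ⟩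
  ι (n !) * sumTo n (λ m → cs m * sumTo m (λ j → (- 1#) ^ j * ι (m C j) * (F ⊛ expS (x - ι j)) n))
    ≈⟨ trans (x*Σyz≈Σy*xz n _ cs _) (sumTo-cong n (λ m → *-congˡ (x*Σyz≈Σy*xz m _ _ _))) ⟩
  sumTo n (λ m → cs m * sumTo m (λ j → (- 1#) ^ j * ι (m C j) * (ι (n !) * (F ⊛ expS (x - ι j)) n)))
    ≈⟨ sumTo-cong n (λ m → *-congˡ (sumTo-cong m (λ j → *-congˡ (n!*[F⊛expS]ₙ F (x - ι j) n)))) ⟩
  sumTo n (λ m → cs m * sumTo m (λ j → (- 1#) ^ j * ι (m C j) *
    sumTo n (λ l → ι (n C l) * H r lam (n ∸ l) * (x - ι j) ^ l))) ∎
  where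
  open Series K
  open Expansion K
  open SetoidReasoning setoid
  F : PS
  F = FE lam r
  cs : ℕ → Carrier
  cs m = invZPow (ι (suc m)) k
  expand : ∀ m → (F ⊛ (powPS 1-e⁻ᵗ m ⊛ expS x)) n ≈
                 sumTo m (λ j → (- 1#) ^ j * ι (m C j) * (F ⊛ expS (x - ι j)) n)
  expand m = trans (⊛-congˡ F _ _ n (λ i _ → powPS-1-e⁻ᵗ-⊛-expS x m i))
                   (⊛-distribˡ-sumTo m (λ j → (- 1#) ^ j * ι (m C j)) (λ j → expS (x - ι j)) F n)
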